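{- Let $s \geq 1$ be an integer and let $\alpha_{s,2}$ be the type-$\alpha$ comb with $s$ teeth of length $2$. Then the number of linear extensions of $\alpha_{s,2}$ that avoid the pattern $312$ equals $C_{s+1}-C_s$, where $C_m = \frac{1}{m+1}\binom{2m}{m}$ is the $m$th Catalan number.
   Context: A linear extension of a finite poset $P$ on a set of integers is a listing $v=[v_1,\dots,v_n]$ of all elements of $P$, each exactly once, such that whenever $a \leq_P b$, $a$ appears before $b$. For $w \in S_3$, a sequence $v$ of distinct integers contains $w$ if there are indices $i<j<k$ with $(v_i,v_j,v_k)$ in the same relative order as $(w_1,w_2,w_3)$; otherwise $v$ avoids $w$. The type-$\alpha$ comb $\alpha_{s,t}$ is the poset on $\{1,\dots,st\}$ whose order is generated by the relations $i \leq i+1$ for $1 \leq i \leq s-1$ (the spine $1,\dots,s$) and $x \leq x+s$ for $1 \leq x \leq (t-1)s$. For $t=2$ this means: $1 \le 2 \le \dots \le s$ and $c \le c+s$ for $1 \le c \le s$. -}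

module Defs where

open import Data.Nat using (ℕ; zero; suc; _+_; _*_; _∸_; _/_; _≤_; _<_)
open import Data.Nat.Combinatorics using (_C_)
open import Data.Fin using (Fin; toℕ)
open import Data.List using (List; length; lookup; applyUpTo)
open import Data.List.Relation.Binary.Permutation.Propositional using (_↭_)
open import Data.Product using (_×_; Σ; ∃; _,_)
open import Relation.Binary.PropositionalEquality using (_≡_; _≢_)
open import Relation.Binary.Construct.Closure.ReflexiveTransitive using (Star)
open import Relation.Nullary using (¬_)
open import Function.Bundles using (_⇔_)

catalan : ℕ → ℕ
catalan m = ((2 * m) C m) / suc m

data CombGen (s t : ℕ) : ℕ → ℕ → Set where
  spine : ∀ {i} → 1 ≤ i → i + 1 ≤ s → CombGen s t i (i + 1)
  tooth : ∀ {x} → 1 ≤ x → x ≤ (t ∸ 1) * s → CombGen s t x (x + s)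

_≤[α_,_]_ : ℕ → ℕ → ℕ → ℕ → Set
a ≤[α s , t ] b = Star (CombGen s t) a b

ground : ℕ → List ℕ
ground n = applyUpTo suc n

IsLinExt : ℕ → ℕ → List ℕ → Set
IsLinExt s t v =
  (v ↭ ground (s * t)) ×
  (∀ a b → a ≤[α s , t ] b → a ≢ b →
     Σ (Fin (length v)) λ i → Σ (Fin (length v)) λ j →
       (toℕ i < toℕ j) × (lookup v i ≡ a) × (lookup v j ≡ b))

Contains : ℕ → ℕ → ℕ → List ℕ → Set
Contains w₁ w₂ w₃ v =
  Σ (Fin (length v)) λ i → Σ (Fin (length v)) λ j → Σ (Fin (length v)) λ k →
    (toℕ i < toℕ j) × (toℕ j < toℕ k) ×
    ((lookup v i < lookup v j) ⇔ (w₁ < w₂)) ×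
    ((lookup v j < lookup v i) ⇔ (w₂ < w₁)) ×
    ((lookup v i < lookup v k) ⇔ (w₁ < w₃)) ×
    ((lookup v k < lookup v i) ⇔ (w₃ < w₁)) ×
    ((lookup v j < lookup v k) ⇔ (w₂ < w₃)) ×
    ((lookup v k < lookup v j) ⇔ (w₃ < w₂))

Avoids : ℕ → ℕ → ℕ → List ℕ → Set
Avoids w₁ w₂ w₃ v = ¬ Contains w₁ w₂ w₃ v

module Submission where

-- A 312-avoiding linear extension of α_{s,2} begins 1, 2, …, s−1: after
-- 1, …, k with k+1 < s comes some x > k, and x ≠ k+1 is impossible, since an
-- x ≤ s must follow k+1 on the spine while an x > s starts a 312 with k+1, k+2.
-- The rest is a 312-avoiding arrangement of s, …, 2s in which s precedes 2s,
-- and every such arrangement completes the prefix to an extension.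
-- The 312-avoiding arrangements of an increasing input are exactly the outputs
-- of a stack, each produced by a single run, so exploring the runs lists them
-- without repetition.  Runs are counted by ballot numbers: those in which s,
-- pushed first, is popped before 2s is read number ballot(s+1, 0) − ballot(s, 0),
-- and ballot(m, 0) = C_m by the reflection principle.

open import Data.Nat
open import Data.Nat.Properties
open import Data.Nat.Combinatorics using (_C_; nCk+nC[k+1]≡[n+1]C[k+1]; k>n⇒nCk≡0; nCk≡nC[n∸k]; nC1≡n)
open import Data.Nat.DivMod using (m*n/n≡m)
open import Data.Nat.Tactic.RingSolver using (solve-∀)
open import Data.Fin using (Fin; toℕ) renaming (zero to fzero; suc to fsuc)
open import Data.List using (List; []; _∷_; _++_; map; length; lookup)
open import Data.List.Properties using (++-identityʳ; ++-assoc; ++-cancelˡ; length-++; length-map; ∷-injectiveʳ; applyUpTo-∷ʳ)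
open import Data.List.Membership.Propositional using (_∈_; _∉_)
open import Data.List.Membership.Propositional.Properties
  using (∈-++⁻; ∈-++⁺ˡ; ∈-++⁺ʳ; ∈-map⁻; ∈-map⁺; ∈-lookup; ∈-applyUpTo⁻; ∈-applyUpTo⁺)
open import Data.List.Membership.Propositional.Properties.WithK using (unique∧set⇒bag)
open import Data.List.Relation.Unary.Any using (here; there; index)
open import Data.List.Relation.Unary.Any.Properties using (lookup-index)
open import Data.List.Relation.Unary.All as All using (All; []; _∷_)
open import Data.List.Relation.Unary.All.Properties using (¬Any⇒All¬)
open import Data.List.Relation.Unary.AllPairs as AllPairs using (AllPairs; []; _∷_)
open import Data.List.Relation.Unary.Unique.Propositional using (Unique)
open import Data.List.Relation.Unary.Unique.Propositional.Properties using (Unique[x∷xs]⇒x∉xs; ++⁺; map⁺; applyUpTo⁺₁)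
open import Data.List.Relation.Binary.Permutation.Propositional using (_↭_; ↭-sym; ↭⇒↭ₛ)
open import Data.List.Relation.Binary.Permutation.Propositional.Properties using (∈-resp-↭)
import Data.List.Relation.Binary.Permutation.Setoid.Properties as Permutationₛ
open import Data.List.Relation.Binary.BagAndSetEquality using (∼bag⇒↭)
open import Data.Product using (Σ; _×_; _,_; proj₁; proj₂)
open import Data.Sum using (_⊎_; inj₁; inj₂)
open import Data.Unit using (⊤; tt)
open import Data.Empty using (⊥; ⊥-elim)
open import Relation.Nullary using (¬_; yes; no)
open import Relation.Binary.PropositionalEquality
open import Relation.Binary.Construct.Closure.ReflexiveTransitive using (Star; ε; _◅_)
open import Function using (_∘_)
open import Function.Bundles using (_⇔_; mk⇔; Equivalence)
open import Defs

pascal : ∀ n k → suc n C suc k ≡ n C k + n C suc k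
pascal n k = sym (nCk+nC[k+1]≡[n+1]C[k+1] n k)

C-absorption : ∀ n k → suc k * (suc n C suc k) ≡ suc n * (n C k)
C-absorption n       zero    = trans (*-identityˡ _) (trans (nC1≡n (suc n)) (sym (*-identityʳ (suc n))))
C-absorption zero    (suc k) = begin
  suc (suc k) * (1 C suc (suc k)) ≡⟨ cong (suc (suc k) *_) (k>n⇒nCk≡0 {1} (s≤s (s≤s (z≤n {k})))) ⟩
  suc (suc k) * 0                 ≡⟨ *-zeroʳ (suc (suc k)) ⟩
  0                               ≡⟨ cong (1 *_) (k>n⇒nCk≡0 {0} (s≤s (z≤n {k}))) ⟨
  1 * (0 C suc k)                 ∎
  where open ≡-Reasoning
C-absorption (suc n) (suc k) = begin
  suc (suc k) * (suc (suc n) C suc (suc k))         ≡⟨ cong (suc (suc k) *_) (pascal (suc n) (suc k)) ⟩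
  suc (suc k) * (a + b)                              ≡⟨ distribute (suc k) a b ⟩
  (suc k * a + a) + suc (suc k) * b                  ≡⟨ cong₂ (λ x y → x + a + y) (C-absorption n k) (C-absorption n (suc k)) ⟩
  (suc n * (n C k) + a) + suc n * (n C suc k)        ≡⟨ collect (suc n) (n C k) (n C suc k) a ⟩
  suc n * (n C k + n C suc k) + a                    ≡⟨ cong (λ x → suc n * x + a) (pascal n k) ⟨
  suc n * a + a                                      ≡⟨ +-comm (suc n * a) a ⟩
  suc (suc n) * a                                    ∎
  where
  open ≡-Reasoning
  a = suc n C suc k
  b = suc n C suc (suc k)
  distribute : ∀ k a b → suc k * (a + b) ≡ (k * a + a) + suc k * b
  distribute = solve-∀
  collect : ∀ m x y a → (m * x + a) + m * y ≡ m * (x + y) + a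
  collect = solve-∀

-- ballot i h counts the ways to finish a stack run with i inputs still to be
-- pushed and h items on the stack, each step pushing an input or popping.
ballot : ℕ → ℕ → ℕ
ballot zero    h       = 1
ballot (suc i) zero    = ballot i 1
ballot (suc i) (suc h) = ballot i (suc (suc h)) + ballot (suc i) h

ballot-one : ∀ h → ballot 1 h ≡ suc h
ballot-one zero    = refl
ballot-one (suc h) = cong suc (ballot-one h)

-- The reflection principle: ballot (i+1) h = C(n, i+1) − C(n, i) for n = 2i+h+2.
-- The size n is passed with an equation so that the recursion can reach it.
ballot-reflection : ∀ i h n → n ≡ suc (suc (i + i + h)) → ballot (suc i) h + n C i ≡ n C suc i
ballot-reflection zero h n refl rewrite ballot-one h | nC1≡n (suc (suc h)) = +-comm (suc h) 1
ballot-reflection (suc j) zero (suc n) eq = begin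
  ballot (suc j) 1 + suc n C suc j        ≡⟨ cong (ballot (suc j) 1 +_) (pascal n j) ⟩
  ballot (suc j) 1 + (n C j + n C suc j)  ≡⟨ +-assoc (ballot (suc j) 1) _ _ ⟨
  (ballot (suc j) 1 + n C j) + n C suc j  ≡⟨ cong (_+ n C suc j) (ballot-reflection j 1 n n≡) ⟩
  n C suc j + n C suc j                   ≡⟨ cong (n C suc j +_) symmetric ⟩
  n C suc j + n C suc (suc j)             ≡⟨ pascal n (suc j) ⟨
  suc n C suc (suc j)                     ∎
  where
  open ≡-Reasoning
  n≡ : n ≡ suc (suc (j + j + 1))
  n≡ = trans (suc-injective eq) (cong (λ x → suc (suc x)) (rearrange j))
    where rearrange : ∀ j → j + suc j + 0 ≡ j + j + 1
          rearrange = solve-∀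
  symmetric : n C suc j ≡ n C suc (suc j)
  symmetric rewrite n≡ = trans (cong (suc (suc (j + j + 1)) C_) (sym complement))
                                (sym (nCk≡nC[n∸k] (s≤s (s≤s (≤-trans (m≤m+n j j) (m≤m+n _ 1))))))
    where
    complement : suc (suc (j + j + 1)) ∸ suc (suc j) ≡ suc j
    complement = trans (cong (_∸ j) (+-assoc j j 1)) (trans (m+n∸m≡n j (j + 1)) (+-comm j 1))
ballot-reflection (suc j) (suc h) (suc n) eq = begin
  (ballot (suc j) (2 + h) + ballot (2 + j) h) + suc n C suc j
    ≡⟨ cong ((ballot (suc j) (2 + h) + ballot (2 + j) h) +_) (pascal n j) ⟩
  (ballot (suc j) (2 + h) + ballot (2 + j) h) + (n C j + n C suc j)
    ≡⟨ interchange (ballot (suc j) (2 + h)) (ballot (2 + j) h) (n C j) (n C suc j) ⟩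
  (ballot (suc j) (2 + h) + n C j) + (ballot (2 + j) h + n C suc j)
    ≡⟨ cong₂ _+_ (ballot-reflection j (2 + h) n n≡₁) (ballot-reflection (suc j) h n n≡₂) ⟩
  n C suc j + n C suc (suc j)
    ≡⟨ pascal n (suc j) ⟨
  suc n C suc (suc j) ∎
  where
  open ≡-Reasoning
  interchange : ∀ a b c d → (a + b) + (c + d) ≡ (a + c) + (b + d)
  interchange = solve-∀
  n≡₁ : n ≡ suc (suc (j + j + suc (suc h)))
  n≡₁ = trans (suc-injective eq) (cong (λ x → suc (suc x)) (rearrange j h))
    where rearrange : ∀ j h → j + suc j + suc h ≡ j + j + suc (suc h)
          rearrange = solve-∀
  n≡₂ : n ≡ suc (suc (suc j + suc j + h))
  n≡₂ = trans (suc-injective eq) (cong (λ x → suc (suc x)) (rearrange j h))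
    where rearrange : ∀ j h → j + suc j + suc h ≡ suc (j + suc j + h)
          rearrange = solve-∀

C-below-central : ∀ i → suc (suc i) * (suc (suc (i + i)) C i) ≡ suc i * (suc (suc (i + i)) C suc i)
C-below-central i = begin
  suc (suc i) * (N C i)            ≡⟨ cong (suc (suc i) *_) symmetric₁ ⟩
  suc (suc i) * (N C suc (suc i))  ≡⟨ C-absorption (suc (i + i)) (suc i) ⟩
  N * (suc (i + i) C suc i)        ≡⟨ cong (N *_) symmetric₂ ⟩
  N * (suc (i + i) C i)            ≡⟨ C-absorption (suc (i + i)) i ⟨
  suc i * (N C suc i)              ∎
  where
  open ≡-Reasoning
  N = suc (suc (i + i))
  symmetric₁ : N C i ≡ N C suc (suc i)
  symmetric₁ = trans (nCk≡nC[n∸k] (≤-trans (m≤m+n i i) (≤-trans (n≤1+n _) (n≤1+n _))))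
                     (cong (N C_) (trans (+-∸-assoc 2 (m≤m+n i i)) (cong (2 +_) (m+n∸m≡n i i))))
  symmetric₂ : suc (i + i) C suc i ≡ suc (i + i) C i
  symmetric₂ = trans (nCk≡nC[n∸k] (s≤s (m≤m+n i i))) (cong (suc (i + i) C_) (m+n∸m≡n i i))

ballot-central : ∀ m → ballot m 0 * suc m ≡ (2 * m) C m
ballot-central zero    = refl
ballot-central (suc i) = trans (+-cancelʳ-≡ (suc i * b) _ _ (begin
  g * suc (suc i) + suc i * b          ≡⟨ cong (g * suc (suc i) +_) (C-below-central i) ⟨
  g * suc (suc i) + suc (suc i) * a    ≡⟨ factor i g a ⟩
  suc (suc i) * (g + a)                ≡⟨ cong (suc (suc i) *_) (ballot-reflection i 0 N (cong (λ x → suc (suc x)) (sym (+-identityʳ (i + i))))) ⟩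
  b + suc i * b                        ∎))
  (cong (_C suc i) (double i))
  where
  open ≡-Reasoning
  N = suc (suc (i + i))
  g = ballot (suc i) 0
  a = N C i
  b = N C suc i
  factor : ∀ i g a → g * suc (suc i) + suc (suc i) * a ≡ suc (suc i) * (g + a)
  factor = solve-∀
  double : ∀ i → suc (suc (i + i)) ≡ 2 * suc i
  double = solve-∀

catalan≡ballot : ∀ m → catalan m ≡ ballot m 0
catalan≡ballot m = trans (cong (_/ suc m) (sym (ballot-central m))) (m*n/n≡m (ballot m 0) (suc m))

module _ {A : Set} where

  Unique-∷ : ∀ {x : A} {xs} → x ∉ xs → Unique xs → Unique (x ∷ xs)
  Unique-∷ {xs = xs} x∉xs u = ¬Any⇒All¬ xs x∉xs ∷ u

  Unique-++⁻ʳ : ∀ (xs : List A) {ys} → Unique (xs ++ ys) → Unique ys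
  Unique-++⁻ʳ []       u       = u
  Unique-++⁻ʳ (x ∷ xs) (_ ∷ u) = Unique-++⁻ʳ xs u

  Unique-++-disjoint : ∀ (xs : List A) {ys x} → Unique (xs ++ ys) → x ∈ xs → x ∉ ys
  Unique-++-disjoint (x ∷ xs) u (here refl) x∈ys = Unique[x∷xs]⇒x∉xs u (∈-++⁺ʳ xs x∈ys)
  Unique-++-disjoint (x ∷ xs) (_ ∷ u) (there p) = Unique-++-disjoint xs u p

  Unique-map-∷-++ : ∀ (y : A) {xss yss : List (List A)} → Unique xss → Unique yss →
                    (∀ {v} → y ∷ v ∉ yss) → Unique (map (y ∷_) xss ++ yss)
  Unique-map-∷-++ y u u′ y∉ = ++⁺ (map⁺ ∷-injectiveʳ u) u′ disjoint
    where
    disjoint : ∀ {w} → ¬ (w ∈ map (y ∷_) _ × w ∈ _)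
    disjoint (p , q) with ∈-map⁻ (y ∷_) p
    ... | _ , _ , refl = y∉ q

  data Before (y z : A) : List A → Set where
    first : ∀ {w} → z ∈ w → Before y z (y ∷ w)
    later : ∀ {x w} → Before y z w → Before y z (x ∷ w)

  Before-∈ˡ : ∀ {y z w} → Before y z w → y ∈ w
  Before-∈ˡ (first _) = here refl
  Before-∈ˡ (later b) = there (Before-∈ˡ b)

  Before-∈ʳ : ∀ {y z w} → Before y z w → z ∈ w
  Before-∈ʳ (first p) = there p
  Before-∈ʳ (later b) = there (Before-∈ʳ b)

  Before-asym : ∀ {y z w} → Unique w → Before y z w → ¬ Before z y w
  Before-asym u       (first p) (first q) = Unique[x∷xs]⇒x∉xs u q
  Before-asym u       (first p) (later q) = Unique[x∷xs]⇒x∉xs u (Before-∈ʳ q)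
  Before-asym u       (later p) (first q) = Unique[x∷xs]⇒x∉xs u (Before-∈ʳ p)
  Before-asym (_ ∷ u) (later p) (later q) = Before-asym u p q

  Before-trans : ∀ {a b c w} → Unique w → Before a b w → Before b c w → Before a c w
  Before-trans u       (first p) (first q) = first q
  Before-trans u       (first p) (later q) = first (Before-∈ʳ q)
  Before-trans u       (later p) (first q) = ⊥-elim (Unique[x∷xs]⇒x∉xs u (Before-∈ʳ p))
  Before-trans (_ ∷ u) (later p) (later q) = later (Before-trans u p q)

  Before-total : ∀ {y z w} → y ∈ w → z ∈ w → y ≢ z → Before y z w ⊎ Before z y w
  Before-total (here refl) (here refl) y≢z = ⊥-elim (y≢z refl)
  Before-total (here refl) (there q)   _   = inj₁ (first q)
  Before-total (there p)   (here refl) _   = inj₂ (first p)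
  Before-total (there p)   (there q)   y≢z with Before-total p q y≢z
  ... | inj₁ b = inj₁ (later b)
  ... | inj₂ b = inj₂ (later b)

  Before-tail : ∀ {y z x w} → Before y z (x ∷ w) → y ≢ x → Before y z w
  Before-tail (first _) y≢x = ⊥-elim (y≢x refl)
  Before-tail (later b) _   = b

  Before-++⁺ʳ : ∀ (xs : List A) {y z w} → Before y z w → Before y z (xs ++ w)
  Before-++⁺ʳ []       b = b
  Before-++⁺ʳ (x ∷ xs) b = later (Before-++⁺ʳ xs b)

  Before-++ : ∀ {xs : List A} {w y z} → y ∈ xs → z ∈ w → Before y z (xs ++ w)
  Before-++ {_ ∷ xs} (here refl) z∈w = first (∈-++⁺ʳ xs z∈w)
  Before-++          (there p)   z∈w = later (Before-++ p z∈w)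

  Before-++⁻ʳ : ∀ (xs : List A) {y z w} → Before y z (xs ++ w) → y ∉ xs → Before y z w
  Before-++⁻ʳ []       b y∉xs = b
  Before-++⁻ʳ (x ∷ xs) b y∉xs = Before-++⁻ʳ xs (Before-tail b (y∉xs ∘ here)) (y∉xs ∘ there)

  Before-lookup : ∀ (w : List A) (j k : Fin (length w)) → toℕ j < toℕ k → Before (lookup w j) (lookup w k) w
  Before-lookup (x ∷ w) fzero    (fsuc k) _         = first (∈-lookup k)
  Before-lookup (x ∷ w) (fsuc j) (fsuc k) (s≤s j<k) = later (Before-lookup w j k j<k)

  Before⇒lookup : ∀ {y z w} → Before y z w → Σ (Fin (length w)) λ j → Σ (Fin (length w)) λ k →
                  toℕ j < toℕ k × lookup w j ≡ y × lookup w k ≡ z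
  Before⇒lookup (first p) = fzero , fsuc (index p) , s≤s z≤n , refl , sym (lookup-index p)
  Before⇒lookup (later b) with Before⇒lookup b
  ... | j , k , j<k , refl , refl = fsuc j , fsuc k , s≤s j<k , refl , refl

data Avoids312 : List ℕ → Set where
  []  : Avoids312 []
  _∷_ : ∀ {x w} → (∀ {y z} → z < y → y < x → ¬ Before z y w) → Avoids312 w → Avoids312 (x ∷ w)

Avoids312-++⁻ʳ : ∀ (xs : List ℕ) {w} → Avoids312 (xs ++ w) → Avoids312 w
Avoids312-++⁻ʳ []       av       = av
Avoids312-++⁻ʳ (x ∷ xs) (_ ∷ av) = Avoids312-++⁻ʳ xs av

Avoids312-lookup : ∀ {v} → Avoids312 v → (i j k : Fin (length v)) → toℕ i < toℕ j → toℕ j < toℕ k →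
                   lookup v j < lookup v k → lookup v k < lookup v i → ⊥
Avoids312-lookup {x ∷ v} (hd ∷ _)  fzero    (fsuc j) (fsuc k) _         (s≤s j<k) vj<vk vk<x =
  hd vj<vk vk<x (Before-lookup v j k j<k)
Avoids312-lookup {x ∷ v} (_ ∷ av) (fsuc i) (fsuc j) (fsuc k) (s≤s i<j) (s≤s j<k) vj<vk vk<vi =
  Avoids312-lookup av i j k i<j j<k vj<vk vk<vi

Avoids312⇒Avoids : ∀ {v} → Avoids312 v → Avoids 3 1 2 v
Avoids312⇒Avoids av (i , j , k , i<j , j<k , _ , _ , _ , vk<vi , vj<vk , _) =
  Avoids312-lookup av i j k i<j j<k (Equivalence.from vj<vk 1<2) (Equivalence.from vk<vi 2<3)
  where
  1<2 : 1 < 2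
  1<2 = s≤s (s≤s z≤n)
  2<3 : 2 < 3
  2<3 = s≤s 1<2

Avoids⇒Avoids312 : ∀ v → Avoids 3 1 2 v → Avoids312 v
Avoids⇒Avoids312 []      _   = []
Avoids⇒Avoids312 (x ∷ v) avd = no312 ∷ Avoids⇒Avoids312 v (avd ∘ shift)
  where
  shift : Contains 3 1 2 v → Contains 3 1 2 (x ∷ v)
  shift (i , j , k , i<j , j<k , order) = fsuc i , fsuc j , fsuc k , s≤s i<j , s≤s j<k , order
  no312 : ∀ {y z} → z < y → y < x → ¬ Before z y v
  no312 {y} {z} z<y y<x b with Before⇒lookup b
  ... | j , k , j<k , refl , refl = avd (fzero , fsuc j , fsuc k , s≤s z≤n , s≤s j<k ,
        mk⇔ (λ x<z → ⊥-elim (<-asym x<z z<x)) (λ { (s≤s ()) }) ,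
        mk⇔ (λ _ → s≤s (s≤s z≤n)) (λ _ → z<x) ,
        mk⇔ (λ x<y → ⊥-elim (<-asym x<y y<x)) (λ { (s≤s (s≤s ())) }) ,
        mk⇔ (λ _ → s≤s (s≤s (s≤s z≤n))) (λ _ → y<x) ,
        mk⇔ (λ _ → s≤s (s≤s z≤n)) (λ _ → z<y) ,
        mk⇔ (λ y<z → ⊥-elim (<-asym y<z z<y)) (λ { (s≤s ()) }))
    where
    z<x = <-trans z<y y<x

InRange : ℕ → ℕ → ℕ → Set
InRange n r x = n ≤ x × x < n + r

StackOrder : List ℕ → List ℕ → Set
StackOrder S w = AllPairs (λ y z → Before y z w) S

-- The possible outputs of a stack holding S (top first) while the
-- inputs n, …, n+r−1 are still to be read: the arrangements of S and of those
-- inputs that avoid 312 and pop S from the top down.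
record StackOutput (S : List ℕ) (n r : ℕ) (w : List ℕ) : Set where
  constructor stackOutput
  field
    unique      : Unique w
    ∈⇒          : ∀ {x} → x ∈ w → x ∈ S ⊎ InRange n r x
    ⇒∈          : ∀ {x} → x ∈ S ⊎ InRange n r x → x ∈ w
    avoids      : Avoids312 w
    stack-order : StackOrder S w
open StackOutput public

Decreasing : List ℕ → Set
Decreasing = AllPairs _>_

∉-below : ∀ {y S} → All (_< y) S → y ∉ S
∉-below lt m = <-irrefl refl (All.lookup lt m)

stack-order-later : ∀ {S x w} → StackOrder S w → StackOrder S (x ∷ w)
stack-order-later = AllPairs.map later

stack-order-tail : ∀ {S x w} → StackOrder S (x ∷ w) → x ∉ S → StackOrder S w
stack-order-tail {[]}    []           _   = []
stack-order-tail {y ∷ S} (bs ∷ order) x∉S =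
  All.map (λ b → Before-tail b (λ y≡x → x∉S (here (sym y≡x)))) bs ∷ stack-order-tail order (x∉S ∘ there)

stack-order-Before : ∀ {S w y z} → Decreasing S → StackOrder S w → y ∈ S → z ∈ S → z < y → Before y z w
stack-order-Before (_  ∷ _) (_  ∷ _)     (here refl) (here refl) z<y = ⊥-elim (<-irrefl refl z<y)
stack-order-Before (_  ∷ _) (bs ∷ _)     (here refl) (there q)   _   = All.lookup bs q
stack-order-Before (lt ∷ _) (_  ∷ _)     (there p)   (here refl) z<y = ⊥-elim (<-asym z<y (All.lookup lt p))
stack-order-Before (_  ∷ d) (_  ∷ order) (there p)   (there q)   z<y = stack-order-Before d order p q z<y

-- An element x output before the rest w cannot head a 312: the entries of w
-- below x all come from the stack, which releases them in decreasing order.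
no312-below-stack : ∀ {S w x} → Decreasing S → StackOrder S w → Unique w → (∀ {y} → y ∈ w → y < x → y ∈ S) →
                    ∀ {y z} → z < y → y < x → ¬ Before z y w
no312-below-stack d order u fromStack z<y y<x b = Before-asym u b
  (stack-order-Before d order (fromStack (Before-∈ʳ b) y<x) (fromStack (Before-∈ˡ b) (<-trans z<y y<x)) z<y)

InRange-empty : ∀ {n x} → ¬ InRange n 0 x
InRange-empty {n} (n≤x , x<n+0) = <⇒≱ (subst (_ <_) (+-identityʳ n) x<n+0) n≤x

InRange-first : ∀ n r → InRange n (suc r) n
InRange-first n r = ≤-refl , subst (n <_) (sym (+-suc n r)) (s≤s (m≤m+n n r))

InRange-last : ∀ n r → InRange n (suc r) (n + r)
InRange-last n r = m≤m+n n r , subst (n + r <_) (sym (+-suc n r)) ≤-refl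

InRange-later : ∀ {n r x} → InRange (suc n) r x → InRange n (suc r) x
InRange-later {n} {r} {x} (n<x , x<) = <⇒≤ n<x , subst (x <_) (sym (+-suc n r)) x<

InRange-split : ∀ {n r x} → InRange n (suc r) x → x ≡ n ⊎ InRange (suc n) r x
InRange-split {n} {r} {x} (n≤x , x<) with m≤n⇒m<n∨m≡n n≤x
... | inj₁ n<x = inj₂ (n<x , subst (x <_) (+-suc n r) x<)
... | inj₂ refl = inj₁ refl

module _ {S : List ℕ} {n r : ℕ} where

  pop⇒ : ∀ {y v} → Decreasing (y ∷ S) → All (_< n) (y ∷ S) → StackOutput (y ∷ S) n r (y ∷ v) → StackOutput S n r v
  pop⇒ {y} {v} (lt ∷ _) (y<n ∷ _) (stackOutput u@(_ ∷ u′) ∈⇒V ⇒∈V (_ ∷ av) (_ ∷ order)) =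
    stackOutput u′ ∈⇒′ ⇒∈′ av (stack-order-tail order (∉-below lt))
    where
    ∈⇒′ : ∀ {x} → x ∈ v → x ∈ S ⊎ InRange n r x
    ∈⇒′ m with ∈⇒V (there m)
    ... | inj₁ (here refl) = ⊥-elim (Unique[x∷xs]⇒x∉xs u m)
    ... | inj₁ (there p)   = inj₁ p
    ... | inj₂ q           = inj₂ q
    ⇒∈′ : ∀ {x} → x ∈ S ⊎ InRange n r x → x ∈ v
    ⇒∈′ (inj₁ p) with ⇒∈V (inj₁ (there p))
    ... | here refl = ⊥-elim (∉-below lt p)
    ... | there m   = m
    ⇒∈′ (inj₂ q) with ⇒∈V (inj₂ q)
    ... | here refl = ⊥-elim (<⇒≱ y<n (proj₁ q))
    ... | there m   = m

  pop⇐ : ∀ {y v} → Decreasing (y ∷ S) → All (_< n) (y ∷ S) → StackOutput S n r v → StackOutput (y ∷ S) n r (y ∷ v)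
  pop⇐ {y} {v} (lt ∷ d) (y<n ∷ _) (stackOutput u ∈⇒V ⇒∈V av order) =
    stackOutput (Unique-∷ y∉v u) ∈⇒′ ⇒∈′ (no312-below-stack d order u fromStack ∷ av)
                (All.tabulate (first ∘ ⇒∈V ∘ inj₁) ∷ stack-order-later order)
    where
    y∉v : y ∉ v
    y∉v m with ∈⇒V m
    ... | inj₁ p       = ∉-below lt p
    ... | inj₂ (n≤y , _) = <⇒≱ y<n n≤y
    ∈⇒′ : ∀ {x} → x ∈ y ∷ v → x ∈ y ∷ S ⊎ InRange n r x
    ∈⇒′ (here refl) = inj₁ (here refl)
    ∈⇒′ (there m) with ∈⇒V m
    ... | inj₁ p = inj₁ (there p)
    ... | inj₂ q = inj₂ q
    ⇒∈′ : ∀ {x} → x ∈ y ∷ S ⊎ InRange n r x → x ∈ y ∷ v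
    ⇒∈′ (inj₁ (here refl)) = here refl
    ⇒∈′ (inj₁ (there p))   = there (⇒∈V (inj₁ p))
    ⇒∈′ (inj₂ q)           = there (⇒∈V (inj₂ q))
    fromStack : ∀ {z} → z ∈ v → z < y → z ∈ S
    fromStack m z<y with ∈⇒V m
    ... | inj₁ p         = p
    ... | inj₂ (n≤z , _) = ⊥-elim (<⇒≱ (<-trans z<y y<n) n≤z)

  emit⇒ : ∀ {v} → All (_< n) S → StackOutput S n (suc r) (n ∷ v) → StackOutput S (suc n) r v
  emit⇒ {v} lt (stackOutput u@(_ ∷ u′) ∈⇒V ⇒∈V (_ ∷ av) order) =
    stackOutput u′ ∈⇒′ ⇒∈′ av (stack-order-tail order (∉-below lt))
    where
    ∈⇒′ : ∀ {x} → x ∈ v → x ∈ S ⊎ InRange (suc n) r x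
    ∈⇒′ m with ∈⇒V (there m)
    ... | inj₁ p = inj₁ p
    ... | inj₂ q with InRange-split q
    ...   | inj₁ refl = ⊥-elim (Unique[x∷xs]⇒x∉xs u m)
    ...   | inj₂ q′   = inj₂ q′
    ⇒∈′ : ∀ {x} → x ∈ S ⊎ InRange (suc n) r x → x ∈ v
    ⇒∈′ (inj₁ p) with ⇒∈V (inj₁ p)
    ... | here refl = ⊥-elim (∉-below lt p)
    ... | there m   = m
    ⇒∈′ (inj₂ q) with ⇒∈V (inj₂ (InRange-later q))
    ... | here refl = ⊥-elim (<-irrefl refl (proj₁ q))
    ... | there m   = m

  emit⇐ : ∀ {v} → Decreasing S → All (_< n) S → StackOutput S (suc n) r v → StackOutput S n (suc r) (n ∷ v)
  emit⇐ {v} d lt (stackOutput u ∈⇒V ⇒∈V av order) =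
    stackOutput (Unique-∷ n∉v u) ∈⇒′ ⇒∈′ (no312-below-stack d order u fromStack ∷ av) (stack-order-later order)
    where
    n∉v : n ∉ v
    n∉v m with ∈⇒V m
    ... | inj₁ p        = ∉-below lt p
    ... | inj₂ (n<n , _) = <-irrefl refl n<n
    ∈⇒′ : ∀ {x} → x ∈ n ∷ v → x ∈ S ⊎ InRange n (suc r) x
    ∈⇒′ (here refl) = inj₂ (InRange-first n r)
    ∈⇒′ (there m) with ∈⇒V m
    ... | inj₁ p = inj₁ p
    ... | inj₂ q = inj₂ (InRange-later q)
    ⇒∈′ : ∀ {x} → x ∈ S ⊎ InRange n (suc r) x → x ∈ n ∷ v
    ⇒∈′ (inj₁ p) = there (⇒∈V (inj₁ p))
    ⇒∈′ (inj₂ q) with InRange-split q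
    ... | inj₁ refl = here refl
    ... | inj₂ q′   = there (⇒∈V (inj₂ q′))
    fromStack : ∀ {z} → z ∈ v → z < n → z ∈ S
    fromStack m z<n with ∈⇒V m
    ... | inj₁ p         = p
    ... | inj₂ (n<z , _) = ⊥-elim (<-asym z<n n<z)

  push⇒ : ∀ {x v} → All (_< n) S → n < x → StackOutput S n (suc r) (x ∷ v) → StackOutput (n ∷ S) (suc n) r (x ∷ v)
  push⇒ {x} {v} lt n<x (stackOutput u ∈⇒V ⇒∈V av@(no312 ∷ _) order) =
    stackOutput u ∈⇒′ ⇒∈′ av (All.tabulate n-before ∷ order)
    where
    ∈⇒′ : ∀ {z} → z ∈ x ∷ v → z ∈ n ∷ S ⊎ InRange (suc n) r z
    ∈⇒′ m with ∈⇒V m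
    ... | inj₁ p = inj₁ (there p)
    ... | inj₂ q with InRange-split q
    ...   | inj₁ refl = inj₁ (here refl)
    ...   | inj₂ q′   = inj₂ q′
    ⇒∈′ : ∀ {z} → z ∈ n ∷ S ⊎ InRange (suc n) r z → z ∈ x ∷ v
    ⇒∈′ (inj₁ (here refl)) = ⇒∈V (inj₂ (InRange-first n r))
    ⇒∈′ (inj₁ (there p))   = ⇒∈V (inj₁ p)
    ⇒∈′ (inj₂ q)           = ⇒∈V (inj₂ (InRange-later q))
    -- n is still to be output after x > n, so any z < n of S must follow n.
    n-before : ∀ {z} → z ∈ S → Before n z (x ∷ v)
    n-before {z} p with ⇒∈V (inj₂ (InRange-first n r)) | ⇒∈V (inj₁ p)
    ... | here n≡x | _         = ⊥-elim (<-irrefl n≡x n<x)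
    ... | there _  | here z≡x  = ⊥-elim (<-irrefl z≡x (<-trans (All.lookup lt p) n<x))
    ... | there n∈ | there z∈ with Before-total n∈ z∈ (λ n≡z → <-irrefl (sym n≡z) (All.lookup lt p))
    ...   | inj₁ b = later b
    ...   | inj₂ b = ⊥-elim (no312 (All.lookup lt p) n<x b)

  push⇐ : ∀ {w} → StackOutput (n ∷ S) (suc n) r w → StackOutput S n (suc r) w
  push⇐ {w} (stackOutput u ∈⇒V ⇒∈V av (_ ∷ order)) = stackOutput u ∈⇒′ ⇒∈′ av order
    where
    ∈⇒′ : ∀ {z} → z ∈ w → z ∈ S ⊎ InRange n (suc r) z
    ∈⇒′ m with ∈⇒V m
    ... | inj₁ (here refl) = inj₂ (InRange-first n r)
    ... | inj₁ (there p)   = inj₁ p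
    ... | inj₂ q           = inj₂ (InRange-later q)
    ⇒∈′ : ∀ {z} → z ∈ S ⊎ InRange n (suc r) z → z ∈ w
    ⇒∈′ (inj₁ p) = ⇒∈V (inj₁ (there p))
    ⇒∈′ (inj₂ q) with InRange-split q
    ... | inj₁ refl = ⇒∈V (inj₁ (here refl))
    ... | inj₂ q′   = ⇒∈V (inj₂ q′)

-- What lies below the stack: nothing, or an element a that must be output
-- before the last input.
data Bottom : Set where
  free    : Bottom
  pending : ℕ → Bottom

below : Bottom → List ℕ
below free        = []
below (pending a) = a ∷ []

stack : Bottom → List ℕ → List ℕ
stack b st = st ++ below b

-- The last input is n+r−1; once it is read, a pending bottom is too late.
Deadline : Bottom → ℕ → ℕ → List ℕ → Set
Deadline free        n r       w = ⊤
Deadline (pending a) n zero    w = ⊥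
Deadline (pending a) n (suc r) w = Before a (n + r) w

Valid : Bottom → List ℕ → ℕ → ℕ → List ℕ → Set
Valid b st n r w = StackOutput (stack b st) n r w × Deadline b n r w

record Invariant (b : Bottom) (st : List ℕ) (n : ℕ) : Set where
  constructor invariant
  field
    decreasing : Decreasing (stack b st)
    bounded    : All (_< n) (stack b st)

finish : Bottom → List ℕ → List (List ℕ)
finish free        st = st ∷ []
finish (pending a) st = []

mutual
  -- One output for each stack run from the stack st (top first) over the bottom b,
  -- with the inputs n, …, n+r−1 still to be read.
  outputs : Bottom → List ℕ → ℕ → ℕ → List (List ℕ)
  outputs b st       n zero    = finish b st
  outputs b []       n (suc r) = popBottom b n r ++ inputFirst b [] n r
  outputs b (y ∷ st) n (suc r) = map (y ∷_) (outputs b st n (suc r)) ++ inputFirst b (y ∷ st) n r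

  popBottom : Bottom → ℕ → ℕ → List (List ℕ)
  popBottom free        n r = []
  popBottom (pending a) n r = map (a ∷_) (inputFirst free [] n r)

  -- The outputs, with r+1 inputs left, that begin with an input: output n at
  -- once, or push it and go on reading.
  inputFirst : Bottom → List ℕ → ℕ → ℕ → List (List ℕ)
  inputFirst b st n zero    = map (n ∷_) (outputs b st (suc n) zero)
  inputFirst b st n (suc r) = map (n ∷_) (outputs b st (suc n) (suc r)) ++ inputFirst b (n ∷ st) (suc n) r

Deadline-later : ∀ {b n r x w} → Deadline b n r w → Deadline b n r (x ∷ w)
Deadline-later {free}                  _  = tt
Deadline-later {pending a} {r = suc r} bf = later bf

Deadline-tail : ∀ {b n r x w} → x ∉ below b → Deadline b n r (x ∷ w) → Deadline b n r w
Deadline-tail {free}                  _   _  = tt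
Deadline-tail {pending a} {r = suc r} x∉a bf = Before-tail bf (λ a≡x → x∉a (here (sym a≡x)))

Deadline-emit⇒ : ∀ {b n r w} → All (_< n) (below b) → n ∉ w → Deadline b n (suc r) (n ∷ w) → Deadline b (suc n) r w
Deadline-emit⇒ {free}                           _          _   _          = tt
Deadline-emit⇒ {pending a}                      (a<n ∷ []) _   (first _)  = ⊥-elim (<-irrefl refl a<n)
Deadline-emit⇒ {pending a} {n} {zero}  {w}      _          n∉w (later bf) = n∉w (subst (_∈ w) (+-identityʳ n) (Before-∈ʳ bf))
Deadline-emit⇒ {pending a} {n} {suc r} {w}      _          _   (later bf) = subst (λ t → Before a t w) (+-suc n r) bf

Deadline-emit⇐ : ∀ {b n r w} → Deadline b (suc n) r w → Deadline b n (suc r) (n ∷ w)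
Deadline-emit⇐ {free}                      _  = tt
Deadline-emit⇐ {pending a} {n} {suc r} {w} bf = later (subst (λ t → Before a t w) (sym (+-suc n r)) bf)

Deadline-push⇒ : ∀ {b n r w} → Deadline b n (suc (suc r)) w → Deadline b (suc n) (suc r) w
Deadline-push⇒ {free}                  _  = tt
Deadline-push⇒ {pending a} {n} {r} {w} bf = subst (λ t → Before a t w) (+-suc n r) bf

Deadline-push⇐ : ∀ {b n r w} → Deadline b (suc n) (suc r) w → Deadline b n (suc (suc r)) w
Deadline-push⇐ {free}                  _  = tt
Deadline-push⇐ {pending a} {n} {r} {w} bf = subst (λ t → Before a t w) (sym (+-suc n r)) bf

Invariant-pop : ∀ {b y st n} → Invariant b (y ∷ st) n → Invariant b st n
Invariant-pop (invariant (_ ∷ d) (_ ∷ lt)) = invariant d lt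

Invariant-emit : ∀ {b st n} → Invariant b st n → Invariant b st (suc n)
Invariant-emit (invariant d lt) = invariant d (All.map m<n⇒m<1+n lt)

Invariant-push : ∀ {b st n} → Invariant b st n → Invariant b (n ∷ st) (suc n)
Invariant-push {n = n} (invariant d lt) = invariant (lt ∷ d) (n<1+n n ∷ All.map m<n⇒m<1+n lt)

stack-output-head : ∀ {y S n r x v} → All (_< y) S → StackOutput (y ∷ S) n r (x ∷ v) → x ∈ y ∷ S → x ≡ y
stack-output-head _  _                                   (here x≡y) = x≡y
stack-output-head lt (stackOutput u _ _ _ (bs ∷ _)) (there p) with All.lookup bs p
... | first _  = ⊥-elim (∉-below lt p)
... | later bf = ⊥-elim (Unique[x∷xs]⇒x∉xs u (Before-∈ʳ bf))

stack-output-final : ∀ {S n} → Decreasing S → All (_< n) S → StackOutput S n 0 S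
stack-output-final {[]}    _ _ = stackOutput [] (λ ()) (λ { (inj₁ ()) ; (inj₂ q) → ⊥-elim (InRange-empty q) }) [] []
stack-output-final {y ∷ S} d@(_ ∷ d′) lt@(_ ∷ lt′) = pop⇐ d lt (stack-output-final d′ lt′)

stack-output-final-unique : ∀ {S n v} → Decreasing S → All (_< n) S → StackOutput S n 0 v → v ≡ S
stack-output-final-unique {[]} {v = []} _ _ _ = refl
stack-output-final-unique {[]} {v = x ∷ v} _ _ V with ∈⇒ V (here refl)
... | inj₂ q = ⊥-elim (InRange-empty q)
stack-output-final-unique {y ∷ S} {v = []} _ _ V with ⇒∈ V (inj₁ (here refl))
... | ()
stack-output-final-unique {y ∷ S} {v = x ∷ v} d@(lt ∷ d′) a@(_ ∷ a′) V with ∈⇒ V (here refl)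
... | inj₂ q = ⊥-elim (InRange-empty q)
... | inj₁ p with stack-output-head lt V p
...   | refl = cong (y ∷_) (stack-output-final-unique d′ a′ (pop⇒ d a V))

outputs-sound    : ∀ b st n r {w} → Invariant b st n → w ∈ outputs b st n r → Valid b st n r w
popBottom-sound  : ∀ b n r {w} → Invariant b [] n → w ∈ popBottom b n r → Valid b [] n (suc r) w
inputFirst-sound : ∀ b st n r {w} → Invariant b st n → w ∈ inputFirst b st n r → Valid b st n (suc r) w
emit-sound       : ∀ b st n r {w} → Invariant b st n → w ∈ map (n ∷_) (outputs b st (suc n) r) → Valid b st n (suc r) w

outputs-sound free st n zero (invariant d lt) (here refl) =
  subst (StackOutput (st ++ []) n 0) (++-identityʳ st) (stack-output-final d lt) , tt
outputs-sound b [] n (suc r) inv m with ∈-++⁻ (popBottom b n r) m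
... | inj₁ m′ = popBottom-sound b n r inv m′
... | inj₂ m′ = inputFirst-sound b [] n r inv m′
outputs-sound b (y ∷ st) n (suc r) inv@(invariant d lt) m with ∈-++⁻ (map (y ∷_) (outputs b st n (suc r))) m
... | inj₂ m′ = inputFirst-sound b (y ∷ st) n r inv m′
... | inj₁ m′ with ∈-map⁻ (y ∷_) m′
...   | _ , m″ , refl with outputs-sound b st n (suc r) (Invariant-pop inv) m″
...     | V , dl = pop⇐ d lt V , Deadline-later dl

popBottom-sound (pending a) n r (invariant d lt) m with ∈-map⁻ (a ∷_) m
... | _ , m′ , refl with inputFirst-sound free [] n r (invariant [] []) m′
...   | V , _ = pop⇐ d lt V , first (⇒∈ V (inj₂ (InRange-last n r)))

inputFirst-sound b st n zero    inv m = emit-sound b st n zero inv m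
inputFirst-sound b st n (suc r) inv m with ∈-++⁻ (map (n ∷_) (outputs b st (suc n) (suc r))) m
... | inj₁ m′ = emit-sound b st n (suc r) inv m′
... | inj₂ m′ with inputFirst-sound b (n ∷ st) (suc n) r (Invariant-push inv) m′
...   | V , dl = push⇐ V , Deadline-push⇐ dl

emit-sound b st n r inv@(invariant d lt) m with ∈-map⁻ (n ∷_) m
... | _ , m′ , refl with outputs-sound b st (suc n) r (Invariant-emit inv) m′
...   | V , dl = emit⇐ d lt V , Deadline-emit⇐ dl

inputFirst-⊆-outputs : ∀ b st n r {w} → w ∈ inputFirst b st n r → w ∈ outputs b st n (suc r)
inputFirst-⊆-outputs b []       n r m = ∈-++⁺ʳ (popBottom b n r) m
inputFirst-⊆-outputs b (y ∷ st) n r m = ∈-++⁺ʳ (map (y ∷_) (outputs b st n (suc r))) m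

emit-∈-inputFirst : ∀ b st n r {w} → w ∈ outputs b st (suc n) r → n ∷ w ∈ inputFirst b st n r
emit-∈-inputFirst b st n zero    m = ∈-map⁺ (n ∷_) m
emit-∈-inputFirst b st n (suc r) m = ∈-++⁺ˡ (∈-map⁺ (n ∷_) m)

outputs-complete    : ∀ b st n r w → Invariant b st n → Valid b st n r w → w ∈ outputs b st n r
inputFirst-complete : ∀ b st n r x v → Invariant b st n → Valid b st n (suc r) (x ∷ v) → n ≤ x →
                      x ∷ v ∈ inputFirst b st n r

outputs-complete free        st n zero w (invariant d lt) (V , _)
  rewrite stack-output-final-unique d lt V = here (++-identityʳ st)
outputs-complete (pending a) st n zero w _ (_ , ())
outputs-complete b st n (suc r) [] _ (V , _) with ⇒∈ V (inj₂ (InRange-first n r))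
... | ()
outputs-complete b st n (suc r) (x ∷ v) inv@(invariant d lt) (V , dl) with ∈⇒ V (here refl)
... | inj₂ (n≤x , _) = inputFirst-⊆-outputs b st n r (inputFirst-complete b st n r x v inv (V , dl) n≤x)
outputs-complete (pending a) [] n (suc r) (x ∷ v) (invariant d lt) (V , dl) | inj₁ (here refl) =
  ∈-++⁺ˡ (∈-map⁺ (a ∷_) (outputs-complete free [] n (suc r) v (invariant [] []) (pop⇒ d lt V , tt)))
outputs-complete b (y ∷ st) n (suc r) (x ∷ v) inv@(invariant d@(y> ∷ _) lt) (V , dl) | inj₁ x∈ with stack-output-head y> V x∈
... | refl = ∈-++⁺ˡ (∈-map⁺ (y ∷_) (outputs-complete b st n (suc r) v (Invariant-pop inv)
               (pop⇒ d lt V , Deadline-tail (λ x∈below → ∉-below y> (∈-++⁺ʳ st x∈below)) dl)))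

inputFirst-complete b st n r x v inv@(invariant d lt) (V , dl) n≤x with m≤n⇒m<n∨m≡n n≤x
... | inj₂ refl = emit-∈-inputFirst b st n r (outputs-complete b st (suc n) r v (Invariant-emit inv)
                    (emit⇒ lt V , Deadline-emit⇒ (All.tabulate (All.lookup lt ∘ ∈-++⁺ʳ st)) (Unique[x∷xs]⇒x∉xs (unique V)) dl))
inputFirst-complete b st n zero x v (invariant d lt) (V , dl) _ | inj₁ n<x with ∈⇒ V (here refl)
... | inj₁ x∈ = ⊥-elim (<-asym n<x (All.lookup lt x∈))
... | inj₂ (_ , x<n+1) = ⊥-elim (<⇒≱ (subst (x <_) (+-comm n 1) x<n+1) n<x)
inputFirst-complete b st n (suc r) x v inv@(invariant d lt) (V , dl) _ | inj₁ n<x =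
  ∈-++⁺ʳ (map (n ∷_) (outputs b st (suc n) (suc r)))
    (inputFirst-complete b (n ∷ st) (suc n) r x v (Invariant-push inv) (push⇒ lt n<x V , Deadline-push⇒ dl) n<x)

below-∉-inputFirst : ∀ b st n r {y v} → y < n → y ∷ v ∉ inputFirst b st n r
below-∉-inputFirst b st n zero    y<n m with ∈-map⁻ (n ∷_) m
... | _ , _ , refl = <-irrefl refl y<n
below-∉-inputFirst b st n (suc r) y<n m with ∈-++⁻ (map (n ∷_) (outputs b st (suc n) (suc r))) m
... | inj₁ m′ with ∈-map⁻ (n ∷_) m′
...   | _ , _ , refl = <-irrefl refl y<n
below-∉-inputFirst b st n (suc r) y<n m | inj₂ m′ = below-∉-inputFirst b (n ∷ st) (suc n) r (m<n⇒m<1+n y<n) m′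

outputs-unique    : ∀ b st n r → Invariant b st n → Unique (outputs b st n r)
inputFirst-unique : ∀ b st n r → Invariant b st n → Unique (inputFirst b st n r)

outputs-unique free        st n zero _ = [] ∷ []
outputs-unique (pending a) st n zero _ = []
outputs-unique free        [] n (suc r) inv = inputFirst-unique free [] n r inv
outputs-unique (pending a) [] n (suc r) inv@(invariant _ (a<n ∷ [])) =
  Unique-map-∷-++ a (inputFirst-unique free [] n r (invariant [] [])) (inputFirst-unique (pending a) [] n r inv)
    (below-∉-inputFirst (pending a) [] n r a<n)
outputs-unique b (y ∷ st) n (suc r) inv@(invariant _ (y<n ∷ _)) =
  Unique-map-∷-++ y (outputs-unique b st n (suc r) (Invariant-pop inv)) (inputFirst-unique b (y ∷ st) n r inv)
    (below-∉-inputFirst b (y ∷ st) n r y<n)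

inputFirst-unique b st n zero    inv = map⁺ ∷-injectiveʳ (outputs-unique b st (suc n) zero (Invariant-emit inv))
inputFirst-unique b st n (suc r) inv =
  Unique-map-∷-++ n (outputs-unique b st (suc n) (suc r) (Invariant-emit inv))
    (inputFirst-unique b (n ∷ st) (suc n) r (Invariant-push inv)) (below-∉-inputFirst b (n ∷ st) (suc n) r (n<1+n n))

length-branch : ∀ {A : Set} (y : A) (xss yss : List (List A)) {a b c} →
                length xss ≡ a → length yss ≡ b → a + b ≡ c → length (map (y ∷_) xss ++ yss) ≡ c
length-branch y xss yss refl refl a+b≡c = trans (length-++ (map (y ∷_) xss)) (trans (cong (_+ length yss) (length-map (y ∷_) xss)) a+b≡c)

-- runs b r h is the number of runs with r inputs left and h items above the bottom b.
runs : Bottom → ℕ → ℕ → ℕ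
runs free        r       h = ballot r h
runs (pending a) zero    h = 0
runs (pending a) (suc r) h = ballot r (suc (suc h))

runs-step : ∀ b r h → runs b (suc r) h + runs b r (suc (suc h)) ≡ runs b (suc r) (suc h)
runs-step free        r       h = +-comm (ballot (suc r) h) _
runs-step (pending a) zero    h = +-identityʳ _
runs-step (pending a) (suc r) h = +-comm (ballot (suc r) (suc (suc h))) _

length-popBottom : ∀ b n r → length (popBottom b n r) + runs b r 1 ≡ runs b (suc r) 0
length-outputs    : ∀ b st n r → length (outputs b st n r) ≡ runs b r (length st)
length-inputFirst : ∀ b st n r → length (inputFirst b st n r) ≡ runs b r (suc (length st))

length-popBottom free        n r = refl
length-popBottom (pending a) n r =
  trans (cong (_+ runs (pending a) r 1) (trans (length-map (a ∷_) (inputFirst free [] n r)) (length-inputFirst free [] n r)))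
        (split r)
  where
  split : ∀ r → ballot r 1 + runs (pending a) r 1 ≡ ballot r 2
  split zero    = refl
  split (suc r) = +-comm (ballot (suc r) 1) _

length-outputs free        st       n zero    = refl
length-outputs (pending a) st       n zero    = refl
length-outputs b           []       n (suc r) =
  trans (length-++ (popBottom b n r)) (trans (cong (length (popBottom b n r) +_) (length-inputFirst b [] n r)) (length-popBottom b n r))
length-outputs b           (y ∷ st) n (suc r) = length-branch y (outputs b st n (suc r)) (inputFirst b (y ∷ st) n r)
  (length-outputs b st n (suc r)) (length-inputFirst b (y ∷ st) n r) (runs-step b r (length st))

length-inputFirst free        st n zero    = refl
length-inputFirst (pending a) st n zero    = refl
length-inputFirst b           st n (suc r) = length-branch n (outputs b st (suc n) (suc r)) (inputFirst b (n ∷ st) (suc n) r)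
  (length-outputs b st (suc n) (suc r)) (length-inputFirst b (n ∷ st) (suc n) r) (runs-step b r (length st))

ground-∈⁻ : ∀ {N x} → x ∈ ground N → 1 ≤ x × x ≤ N
ground-∈⁻ p with ∈-applyUpTo⁻ suc p
... | _ , i<N , refl = s≤s z≤n , i<N

ground-∈⁺ : ∀ {N x} → 1 ≤ x → x ≤ N → x ∈ ground N
ground-∈⁺ {x = suc i} _ i<N = ∈-applyUpTo⁺ suc i<N

ground-unique : ∀ N → Unique (ground N)
ground-unique N = applyUpTo⁺₁ suc N (λ i<j _ → <⇒≢ i<j ∘ suc-injective)

ground-suc-++ : ∀ k w → ground (suc k) ++ w ≡ ground k ++ suc k ∷ w
ground-suc-++ k w = trans (cong (_++ w) (sym (applyUpTo-∷ʳ suc k))) (++-assoc (ground k) (suc k ∷ []) w)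

Before-ground-++ : ∀ {i j} k w → 1 ≤ i → i < j → j ≤ k → Before i j (ground k ++ w)
Before-ground-++ zero    w _   (s≤s _) ()
Before-ground-++ (suc k) w 1≤i i<j j≤k rewrite ground-suc-++ k w with m≤n⇒m<n∨m≡n j≤k
... | inj₁ j<k  = Before-ground-++ k (suc k ∷ w) 1≤i i<j (≤-pred j<k)
... | inj₂ refl = Before-++ (ground-∈⁺ 1≤i (≤-pred i<j)) (here refl)

Avoids312-ground-++ : ∀ k {w} → (∀ {x} → x ∈ w → k < x) → Avoids312 w → Avoids312 (ground k ++ w)
Avoids312-ground-++ zero    _     av = av
Avoids312-ground-++ (suc k) {w} above av rewrite ground-suc-++ k w =
  Avoids312-ground-++ k above′ ((λ {y} _ y<k+1 b → <-asym y<k+1 (above (Before-∈ʳ b))) ∷ av)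
  where
  above′ : ∀ {x} → x ∈ suc k ∷ w → k < x
  above′ (here refl) = ≤-refl
  above′ (there p)   = <-trans (n<1+n k) (above p)

unique-↭ : ∀ {xs ys : List ℕ} → Unique xs → Unique ys → (∀ {x} → x ∈ xs ⇔ x ∈ ys) → xs ↭ ys
unique-↭ u u′ same = ∼bag⇒↭ (unique∧set⇒bag u u′ same)

Unique-resp-↭ : ∀ {xs ys : List ℕ} → xs ↭ ys → Unique xs → Unique ys
Unique-resp-↭ p = Permutationₛ.Unique-resp-↭ (setoid ℕ) (↭⇒↭ₛ p)

Star-Before : ∀ {R : ℕ → ℕ → Set} {v} → Unique v → (∀ {a b} → R a b → Before a b v) →
              ∀ {a b} → Star R a b → a ≢ b → Before a b v
Star-Before u step ε                          a≢b = ⊥-elim (a≢b refl)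
Star-Before u step {b = b} (_◅_ {j = m} r rs) a≢b with m ≟ b
... | yes refl = step r
... | no  m≢b  = Before-trans u (step r) (Star-Before u step rs m≢b)

spine-path : ∀ {s t c d} → 1 ≤ c → c ≤ d → d ≤ s → Star (CombGen s t) c d
spine-path {s} {t} {c} {d} 1≤c c≤d d≤s =
  subst (Star (CombGen s t) c) (m+[n∸m]≡n c≤d) (walk (d ∸ c) 1≤c (subst (_≤ s) (sym (m+[n∸m]≡n c≤d)) d≤s))
  where
  walk : ∀ {c} k → 1 ≤ c → c + k ≤ s → Star (CombGen s t) c (c + k)
  walk {c} zero    _   _   = subst (Star (CombGen s t) c) (sym (+-identityʳ c)) ε
  walk {c} (suc k) 1≤c c+k≤s =
    spine 1≤c (≤-trans (+-monoʳ-≤ c (s≤s (z≤n {k}))) c+k≤s) ◅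
    subst (Star (CombGen s t) (c + 1)) (+-assoc c 1 k)
      (walk k (≤-trans 1≤c (m≤m+n c 1)) (subst (_≤ s) (sym (+-assoc c 1 k)) c+k≤s))

IsLinExt-intro : ∀ {s t v} → Unique v → (∀ {x} → x ∈ v ⇔ x ∈ ground (s * t)) →
                 (∀ {a b} → CombGen s t a b → Before a b v) → IsLinExt s t v
IsLinExt-intro {s} {t} u same step =
  unique-↭ u (ground-unique (s * t)) same , λ a b a≤b a≢b → Before⇒lookup (Star-Before u step a≤b a≢b)

module _ {s t v} (ext : IsLinExt s t v) where

  IsLinExt-unique : Unique v
  IsLinExt-unique = Unique-resp-↭ (↭-sym (proj₁ ext)) (ground-unique (s * t))

  IsLinExt-∈⁻ : ∀ {x} → x ∈ v → x ∈ ground (s * t)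
  IsLinExt-∈⁻ = ∈-resp-↭ (proj₁ ext)

  IsLinExt-∈⁺ : ∀ {x} → x ∈ ground (s * t) → x ∈ v
  IsLinExt-∈⁺ = ∈-resp-↭ (↭-sym (proj₁ ext))

  IsLinExt-Before : ∀ {a b} → a ≤[α s , t ] b → a ≢ b → Before a b v
  IsLinExt-Before {a} {b} a≤b a≢b with proj₂ ext a b a≤b a≢b
  ... | j , k , j<k , refl , refl = Before-lookup v j k j<k

module _ (s′ : ℕ) where

  private
    s : ℕ
    s = suc s′

    s*2≡s+s : s * 2 ≡ s + s
    s*2≡s+s = trans (*-comm s 2) (cong (s +_) (+-identityʳ s))

  -- The arrangements of s, …, 2s with s before 2s, as outputs of a stack with s
  -- pending at the bottom and inputs s+1, …, 2s.
  RestValid : List ℕ → Set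
  RestValid = Valid (pending s) [] (suc s) s

  module _ {w} (valid : RestValid w) where

    rest-∈⁻ : ∀ {x} → x ∈ w → s ≤ x × x ≤ s + s
    rest-∈⁻ m with ∈⇒ (proj₁ valid) m
    ... | inj₁ (here refl)   = ≤-refl , m≤m+n s s
    ... | inj₂ (s<x , x<2s+1) = <⇒≤ s<x , ≤-pred x<2s+1

    rest-∈⁺ : ∀ {x} → s ≤ x → x ≤ s + s → x ∈ w
    rest-∈⁺ s≤x x≤2s with m≤n⇒m<n∨m≡n s≤x
    ... | inj₂ refl = ⇒∈ (proj₁ valid) (inj₁ (here refl))
    ... | inj₁ s<x  = ⇒∈ (proj₁ valid) (inj₂ (s<x , s≤s x≤2s))

    ground-++-rest-∈ : ∀ {x} → x ∈ ground s′ ++ w ⇔ x ∈ ground (s * 2)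
    ground-++-rest-∈ {x} = mk⇔ to from
      where
      to : x ∈ ground s′ ++ w → x ∈ ground (s * 2)
      to m with ∈-++⁻ (ground s′) m
      ... | inj₁ p = let (1≤x , x≤s′) = ground-∈⁻ p in
                     ground-∈⁺ 1≤x (subst (x ≤_) (sym s*2≡s+s) (≤-trans x≤s′ (≤-trans (n≤1+n s′) (m≤m+n s s))))
      ... | inj₂ q = let (s≤x , x≤2s) = rest-∈⁻ q in
                     ground-∈⁺ (≤-trans (s≤s z≤n) s≤x) (subst (x ≤_) (sym s*2≡s+s) x≤2s)
      from : x ∈ ground (s * 2) → x ∈ ground s′ ++ w
      from m with ground-∈⁻ m | x <? s
      ... | 1≤x , _   | yes x<s = ∈-++⁺ˡ (ground-∈⁺ 1≤x (≤-pred x<s))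
      ... | _ , x≤s*2 | no  x≮s = ∈-++⁺ʳ (ground s′) (rest-∈⁺ (≮⇒≥ x≮s) (subst (x ≤_) s*2≡s+s x≤s*2))

    ground-++-rest-unique : Unique (ground s′ ++ w)
    ground-++-rest-unique = ++⁺ (ground-unique s′) (unique (proj₁ valid))
      λ (p , q) → <⇒≱ (s≤s (proj₂ (ground-∈⁻ p))) (proj₁ (rest-∈⁻ q))

    ground-++-rest-Before : ∀ {a b} → CombGen s 2 a b → Before a b (ground s′ ++ w)
    ground-++-rest-Before (spine {i} 1≤i i+1≤s) with m≤n⇒m<n∨m≡n i+1≤s
    ... | inj₁ i+1<s  = Before-ground-++ s′ w 1≤i (m<m+n i (s≤s z≤n)) (≤-pred i+1<s)
    ... | inj₂ i+1≡s = Before-++ (ground-∈⁺ 1≤i (≤-pred (subst (i <_) i+1≡s (m<m+n i (s≤s z≤n)))))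
                                 (subst (_∈ w) (sym i+1≡s) (rest-∈⁺ ≤-refl (m≤m+n s s)))
    ground-++-rest-Before (tooth {x} 1≤x x≤s+0) with m≤n⇒m<n∨m≡n (subst (x ≤_) (+-identityʳ s) x≤s+0)
    ... | inj₁ x<s  = Before-++ (ground-∈⁺ 1≤x (≤-pred x<s)) (rest-∈⁺ (m≤n+m s x) (+-monoˡ-≤ s (<⇒≤ x<s)))
    ... | inj₂ refl = Before-++⁺ʳ (ground s′) (subst (λ t → Before s t w) (cong suc (sym (+-suc s′ s′))) (proj₂ valid))

    ground-++-rest-sound : IsLinExt s 2 (ground s′ ++ w) × Avoids 3 1 2 (ground s′ ++ w)
    ground-++-rest-sound =
      IsLinExt-intro ground-++-rest-unique ground-++-rest-∈ ground-++-rest-Before ,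
      Avoids312⇒Avoids (Avoids312-ground-++ s′ (λ q → proj₁ (rest-∈⁻ q)) (avoids (proj₁ valid)))

  module _ {v} (ext : IsLinExt s 2 v) (av : Avoids312 v) where

    private
      v-unique : Unique v
      v-unique = IsLinExt-unique ext

      v-∈⁻ : ∀ {x} → x ∈ v → 1 ≤ x × x ≤ s + s
      v-∈⁻ {x} m = let (1≤x , x≤s*2) = ground-∈⁻ (IsLinExt-∈⁻ ext m) in 1≤x , subst (x ≤_) s*2≡s+s x≤s*2

      v-∈⁺ : ∀ {x} → 1 ≤ x → x ≤ s + s → x ∈ v
      v-∈⁺ {x} 1≤x x≤2s = IsLinExt-∈⁺ ext (ground-∈⁺ 1≤x (subst (x ≤_) (sym s*2≡s+s) x≤2s))

      Before-past-prefix : ∀ {k a b x u} → v ≡ ground k ++ x ∷ u → Before a b v → k < a → a ≢ x → Before a b u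
      Before-past-prefix {k} eq b k<a a≢x =
        Before-tail (Before-++⁻ʳ (ground k) (subst (Before _ _) eq b) (λ a∈ → <⇒≱ k<a (proj₂ (ground-∈⁻ a∈)))) a≢x

    prefix-next : ∀ {k x u} → suc k ≤ s′ → v ≡ ground k ++ x ∷ u → x ≡ suc k
    prefix-next {k} {x} {u} k<s′ eq with x <? suc k
    ... | yes x≤k = ⊥-elim (Unique-++-disjoint (ground k) (subst Unique eq v-unique)
                      (ground-∈⁺ (proj₁ (v-∈⁻ x∈v)) (≤-pred x≤k)) (here refl))
      where
      x∈v : x ∈ v
      x∈v = subst (x ∈_) (sym eq) (∈-++⁺ʳ (ground k) (here refl))
    ... | no x≮k+1 with m≤n⇒m<n∨m≡n (≮⇒≥ x≮k+1)
    ...   | inj₂ k+1≡x = sym k+1≡x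
    ...   | inj₁ k+1<x with x ≤? s
    ...     | yes x≤s = ⊥-elim (Unique[x∷xs]⇒x∉xs (Unique-++⁻ʳ (ground k) (subst Unique eq v-unique)) (Before-∈ʳ k+1-before-x))
      where
      k+1-before-x : Before (suc k) x u
      k+1-before-x = Before-past-prefix eq
        (IsLinExt-Before ext (spine-path (s≤s z≤n) (<⇒≤ k+1<x) x≤s) (<⇒≢ k+1<x)) ≤-refl (<⇒≢ k+1<x)
    ...     | no x≰s with Avoids312-++⁻ʳ (ground k) (subst Avoids312 eq av)
    ...       | no312 ∷ _ = ⊥-elim (no312 k+1<k+2 (<-≤-trans (s≤s k+2≤s) (≰⇒> x≰s)) k+1-before-k+2)
      where
      k+2≤s : suc k + 1 ≤ s
      k+2≤s = subst (_≤ s) (+-comm 1 (suc k)) (s≤s k<s′)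
      k+1<k+2 : suc k < suc k + 1
      k+1<k+2 = m<m+n (suc k) (s≤s z≤n)
      k+1-before-k+2 : Before (suc k) (suc k + 1) u
      k+1-before-k+2 = Before-past-prefix eq
        (IsLinExt-Before ext (spine (s≤s z≤n) k+2≤s ◅ ε) (<⇒≢ k+1<k+2)) ≤-refl (<⇒≢ k+1<x)

    prefix : ∀ k → k ≤ s′ → Σ (List ℕ) λ u → v ≡ ground k ++ u
    prefix zero    _      = v , refl
    prefix (suc k) k<s′ with prefix k (<⇒≤ k<s′)
    ... | [] , eq = ⊥-elim (<-irrefl refl (s≤s (proj₂ (ground-∈⁻ k+1∈ground))))
      where
      k+1∈ground : suc k ∈ ground k
      k+1∈ground = subst (suc k ∈_) (trans eq (++-identityʳ (ground k)))
                     (v-∈⁺ (s≤s z≤n) (≤-trans (≤-trans k<s′ (n≤1+n s′)) (m≤m+n s s)))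
    ... | x ∷ u , eq with prefix-next k<s′ eq
    ...   | refl = u , trans eq (sym (ground-suc-++ k u))

    rest : List ℕ
    rest = proj₁ (prefix s′ ≤-refl)

    v≡ground++rest : v ≡ ground s′ ++ rest
    v≡ground++rest = proj₂ (prefix s′ ≤-refl)

    rest-valid : RestValid rest
    rest-valid = stackOutput (Unique-++⁻ʳ (ground s′) unique′) ∈⇒′ ⇒∈′
                   (Avoids312-++⁻ʳ (ground s′) (subst Avoids312 v≡ground++rest av)) ([] ∷ []) ,
                 subst (λ t → Before s t rest) (cong suc (+-suc s′ s′)) s-before-2s
      where
      unique′ : Unique (ground s′ ++ rest)
      unique′ = subst Unique v≡ground++rest v-unique
      ∈v : ∀ {x} → x ∈ rest → x ∈ v
      ∈v m = subst (_ ∈_) (sym v≡ground++rest) (∈-++⁺ʳ (ground s′) m)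
      ∉ground : ∀ {x} → s ≤ x → x ∉ ground s′
      ∉ground s≤x x∈ = <⇒≱ (s≤s (proj₂ (ground-∈⁻ x∈))) s≤x
      ∈rest : ∀ {x} → s ≤ x → x ≤ s + s → x ∈ rest
      ∈rest {x} s≤x x≤2s with ∈-++⁻ (ground s′) (subst (x ∈_) v≡ground++rest (v-∈⁺ (≤-trans (s≤s z≤n) s≤x) x≤2s))
      ... | inj₁ x∈ = ⊥-elim (∉ground s≤x x∈)
      ... | inj₂ x∈ = x∈
      ∈⇒′ : ∀ {x} → x ∈ rest → x ∈ s ∷ [] ⊎ InRange (suc s) s x
      ∈⇒′ {x} m with x <? s
      ... | yes x<s = ⊥-elim (Unique-++-disjoint (ground s′) unique′ (ground-∈⁺ (proj₁ (v-∈⁻ (∈v m))) (≤-pred x<s)) m)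
      ... | no x≮s with m≤n⇒m<n∨m≡n (≮⇒≥ x≮s)
      ...   | inj₂ refl = inj₁ (here refl)
      ...   | inj₁ s<x  = inj₂ (s<x , s≤s (proj₂ (v-∈⁻ (∈v m))))
      ⇒∈′ : ∀ {x} → x ∈ s ∷ [] ⊎ InRange (suc s) s x → x ∈ rest
      ⇒∈′ (inj₁ (here refl))     = ∈rest ≤-refl (m≤m+n s s)
      ⇒∈′ (inj₂ (s<x , x<2s+1)) = ∈rest (<⇒≤ s<x) (≤-pred x<2s+1)
      s-before-2s : Before s (s + s) rest
      s-before-2s = Before-++⁻ʳ (ground s′)
        (subst (Before s (s + s)) v≡ground++rest
          (IsLinExt-Before ext (tooth (s≤s z≤n) (m≤m+n s 0) ◅ ε) (<⇒≢ (m<m+n s (s≤s z≤n)))))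
        (∉ground ≤-refl)

  extensions : List (List ℕ)
  extensions = map (ground s′ ++_) (outputs (pending s) [] (suc s) s)

  private
    initial : Invariant (pending s) [] (suc s)
    initial = invariant ([] ∷ []) (≤-refl ∷ [])

  extensions-unique : Unique extensions
  extensions-unique = map⁺ (++-cancelˡ (ground s′) _ _) (outputs-unique (pending s) [] (suc s) s initial)

  extensions-∈ : ∀ v → v ∈ extensions ⇔ (IsLinExt s 2 v × Avoids 3 1 2 v)
  extensions-∈ v = mk⇔ sound complete
    where
    sound : v ∈ extensions → IsLinExt s 2 v × Avoids 3 1 2 v
    sound m with ∈-map⁻ (ground s′ ++_) m
    ... | w , w∈ , refl = ground-++-rest-sound (outputs-sound (pending s) [] (suc s) s initial w∈)
    complete : IsLinExt s 2 v × Avoids 3 1 2 v → v ∈ extensions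
    complete (ext , avd) = subst (_∈ extensions) (sym (v≡ground++rest ext av))
      (∈-map⁺ (ground s′ ++_) (outputs-complete (pending s) [] (suc s) s (rest ext av) initial (rest-valid ext av)))
      where
      av = Avoids⇒Avoids312 v avd

  length-extensions : length extensions ≡ ballot (suc s) 0 ∸ ballot s 0
  length-extensions = begin
    length extensions                              ≡⟨ length-map (ground s′ ++_) (outputs (pending s) [] (suc s) s) ⟩
    length (outputs (pending s) [] (suc s) s)      ≡⟨ length-outputs (pending s) [] (suc s) s ⟩
    ballot s′ 2                                    ≡⟨ m+n∸n≡m (ballot s′ 2) (ballot s 0) ⟨
    ballot s′ 2 + ballot s 0 ∸ ballot s 0          ∎
    where open ≡-Reasoning

theorem6 : (s : ℕ) → 1 ≤ s →
    Σ (List (List ℕ)) λ L →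
    Unique L ×
    (∀ v → (v ∈ L) ⇔ (IsLinExt s 2 v × Avoids 3 1 2 v)) ×
    (length L ≡ catalan (s + 1) ∸ catalan s)
theorem6 (suc s′) _ = extensions s′ , extensions-unique s′ , extensions-∈ s′ , count
  where
  s = suc s′
  count : length (extensions s′) ≡ catalan (s + 1) ∸ catalan s
  count = trans (length-extensions s′)
    (sym (cong₂ _∸_ (trans (cong catalan (+-comm s 1)) (catalan≡ballot (suc s))) (catalan≡ballot s)))
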